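{- Let $t$ be an even positive integer and let $n$ be a positive integer. Then $\Phi_t(n) = d(n)$ and $\Phi_t^+(n) = d(n,\theta)$, where $\theta = \frac{1}{2} + \sqrt{\frac{2n}{t} + \frac{1}{4}}$.
   Context: For $k \in \mathbb{N}$, $t \in \mathbb{N}_0$, $a \in \mathbb{Z}$, let $s_{k,t}(a) = \sum_{i=0}^{k-1}(a+it) = ka + \frac{k(k-1)t}{2}$. Define $\Phi_t(n) = |\{(k,a) \in \mathbb{N}\times\mathbb{Z} : s_{k,t}(a) = n\}|$, the number of representations of $n$ as a sum of a finite arithmetic progression of integers with difference $t$, and $\Phi_t^+(n) = |\{(k,a) \in \mathbb{N}\times\mathbb{N} : s_{k,t}(a) = n\}|$, the number of such representations in which all terms are positive. Here $d(n)$ is the number of positive divisors of $n$, and for a real number $\theta$, $d(n,\theta)$ is the number of positive divisors $d$ of $n$ with $d < \theta$. -}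

module Defs where

open import Data.Nat as ℕ using (ℕ; zero; suc; _≤_; _<_; _∸_; _<?_)
open import Data.Nat.Divisibility using (_∣_; _∣?_)
open import Data.Integer as ℤ using (ℤ; +_)
open import Data.Fin using (Fin)
open import Data.Product using (Σ; _×_; _,_)
open import Data.List using (List; length; filter; upTo; map)
open import Relation.Nullary.Decidable using (_×-dec_)
open import Relation.Binary.PropositionalEquality using (_≡_)
open import Function.Bundles using (_↔_)

s : (t k : ℕ) → ℤ → ℤ
s t zero    a = + 0
s t (suc k) a = s t k a ℤ.+ (a ℤ.+ + (k ℕ.* t))

Rep : ℕ → ℕ → ℕ × ℤ → Set
Rep t n (k , a) = 1 ≤ k × s t k a ≡ + n

RepPos : ℕ → ℕ → ℕ × ℕ → Set
RepPos t n (k , a) = 1 ≤ k × 1 ≤ a × s t k (+ a) ≡ + n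

HasCard : {A : Set} → (A → Set) → ℕ → Set
HasCard {A} P m = Fin m ↔ Σ A P

oneTo : ℕ → List ℕ
oneTo n = map suc (upTo n)

-- d(n) : number of positive divisors of n (every positive divisor of n ≥ 1 is ≤ n)
d : ℕ → ℕ
d n = length (filter (λ k → k ∣? n) (oneTo n))

-- d(n, θ) with θ = 1/2 + sqrt(2n/t + 1/4): number of positive divisors k of n with k < θ.
-- For k ≥ 1 and t > 0:  k < θ  ⇔  (k - 1/2)² < 2n/t + 1/4  ⇔  t·k·(k-1) < 2n.
d-θ : ℕ → ℕ → ℕ
d-θ t n = length (filter (λ k → (k ∣? n) ×-dec (t ℕ.* (k ℕ.* (k ∸ 1)) <? 2 ℕ.* n)) (oneTo n))

{-# OPTIONS --safe #-}
module Submission where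

-- For even t = 2u the progression sum factorises as s_{k,t}(a) = k (a + u (k − 1)).
-- Hence, for n ≥ 1, a representation of n with k terms is exactly a divisor k of n
-- together with the start a = n / k − u (k − 1), which is determined by k; and this
-- start is positive iff u k (k − 1) < n, i.e. iff t k (k − 1) < 2n, i.e. iff k < θ.
-- Throughout, a number of terms k ≥ 1 appears as suc j.

open import Defs
open import Level using (Level)
open import Data.Nat.Base as ℕ using (ℕ; zero; suc; _≤_; _<_; _∸_; z≤n; s≤s; NonZero)
import Data.Nat.Properties as ℕ
open import Data.Nat.Divisibility using (_∣_; _∣?_; divides; ∣⇒≤)
open import Data.Integer.Base as ℤ using (ℤ; +_; ∣_∣)
import Data.Integer.Properties as ℤ
open import Data.Integer.Tactic.RingSolver using (solve-∀)
import Data.Nat.Tactic.RingSolver as ℕ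
open import Algebra.Properties.AbelianGroup ℤ.+-0-abelianGroup
  using () renaming (∙-cancelʳ to +-cancelʳ; //-rightDividesˡ to [x-y]+y≡x)
open import Axiom.UniquenessOfIdentityProofs using (module Decidable⇒UIP)
open import Data.Fin using (Fin)
open import Data.Fin.Properties using (+↔⊎; 1↔⊤)
open import Data.List using (_∷_; length; filter; applyUpTo)
open import Data.List.Properties using (map-upTo)
open import Data.Product using (Σ; _×_; _,_)
open import Data.Product.Function.Dependent.Propositional using (congˡ)
open import Data.Sum using (_⊎_; inj₁; inj₂)
open import Data.Sum.Function.Propositional using (_⊎-cong_)
open import Data.Empty using (⊥-elim)
open import Function.Bundles using (_↔_; _⇔_; mk↔ₛ′; mk⇔; Equivalence)
open import Function.Properties.Inverse using (↔-refl; ↔-trans)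
open import Function.Related.Propositional using (module EquationalReasoning)
open import Relation.Nullary using (¬_; yes; no)
open import Relation.Nullary.Decidable using (True; True-↔; _×-dec_)
open import Relation.Nullary.Irrelevant using (Irrelevant)
open import Relation.Unary using (Decidable)
open import Relation.Binary.PropositionalEquality
  using (_≡_; refl; sym; trans; cong; cong₂; subst; module ≡-Reasoning)

private
  variable
    a : Level
    A B : Set a

×-irrelevant : Irrelevant A → Irrelevant B → Irrelevant (A × B)
×-irrelevant A-irr B-irr (x , y) (x′ , y′) = cong₂ _,_ (A-irr x x′) (B-irr y y′)

Σ-irrelevant : {P : A → Set a} → (∀ {x y} → P x → P y → x ≡ y) → (∀ {x} → Irrelevant (P x)) →
               Irrelevant (Σ A P)
Σ-irrelevant unique P-irr (x , p) (y , q) with refl ← unique p q = cong (x ,_) (P-irr p q)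

⇔⇒↔ : Irrelevant A → Irrelevant B → A ⇔ B → A ↔ B
⇔⇒↔ A-irr B-irr A⇔B = mk↔ₛ′ to from (λ y → B-irr _ y) (λ x → A-irr _ x)
  where open Equivalence A⇔B

∣-irrelevant : ∀ {m n} .{{_ : NonZero m}} → Irrelevant (m ∣ n)
∣-irrelevant {m} (divides q e) (divides q′ e′)
  with refl ← ℕ.*-cancelʳ-≡ q q′ m (trans (sym e) e′) = cong (divides q) (ℕ.≡-irrelevant e e′)

ℤ-≡-irrelevant : {i j : ℤ} → Irrelevant (i ≡ j)
ℤ-≡-irrelevant = Decidable⇒UIP.≡-irrelevant ℤ._≟_

module _ {P : ℕ → Set a} where

  Σ<-suc↔⊎ : ∀ {n} → Σ ℕ (λ i → i < suc n × P i) ↔ (P 0 ⊎ Σ ℕ (λ i → i < n × P (suc i)))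
  Σ<-suc↔⊎ {n} = mk↔ₛ′ to from to∘from from∘to
    where
    to : Σ ℕ (λ i → i < suc n × P i) → P 0 ⊎ Σ ℕ (λ i → i < n × P (suc i))
    to (zero , _ , p) = inj₁ p
    to (suc i , s≤s i<n , p) = inj₂ (i , i<n , p)
    from : P 0 ⊎ Σ ℕ (λ i → i < n × P (suc i)) → Σ ℕ (λ i → i < suc n × P i)
    from (inj₁ p) = zero , s≤s z≤n , p
    from (inj₂ (i , i<n , p)) = suc i , s≤s i<n , p
    to∘from : ∀ y → to (from y) ≡ y
    to∘from (inj₁ _) = refl
    to∘from (inj₂ _) = refl
    from∘to : ∀ x → from (to x) ≡ x
    from∘to (zero , s≤s z≤n , _) = refl
    from∘to (suc _ , s≤s _ , _) = refl

module _ {P : A → Set a} (P? : Decidable P) where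

  filter-∷-↔ : ∀ x xs →
               Fin (length (filter P? (x ∷ xs))) ↔ (True (P? x) ⊎ Fin (length (filter P? xs)))
  filter-∷-↔ x xs with P? x
  ... | yes _ = ↔-trans (+↔⊎ {1}) (1↔⊤ ⊎-cong ↔-refl)
  ... | no _  = mk↔ₛ′ inj₂ (λ { (inj₂ i) → i ; (inj₁ ()) })
                           (λ { (inj₂ _) → refl ; (inj₁ ()) }) (λ _ → refl)

  filter-applyUpTo-↔ : ∀ (f : ℕ → A) → (∀ i → Irrelevant (P (f i))) → ∀ n →
                       Fin (length (filter P? (applyUpTo f n))) ↔ Σ ℕ (λ i → i < n × P (f i))
  filter-applyUpTo-↔ f _ zero = mk↔ₛ′ (λ ()) (λ { (_ , () , _) }) (λ { (_ , () , _) }) (λ ())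
  filter-applyUpTo-↔ f P-irr (suc n) = begin
    Fin (length (filter P? (applyUpTo f (suc n))))
      ↔⟨ filter-∷-↔ (f 0) _ ⟩
    (True (P? (f 0)) ⊎ Fin (length (filter P? (applyUpTo (λ i → f (suc i)) n))))
      ↔⟨ True-↔ (P? (f 0)) (P-irr 0)
           ⊎-cong filter-applyUpTo-↔ (λ i → f (suc i)) (λ i → P-irr (suc i)) n ⟩
    (P (f 0) ⊎ Σ ℕ (λ i → i < n × P (f (suc i))))
      ↔⟨ Σ<-suc↔⊎ ⟨
    Σ ℕ (λ i → i < suc n × P (f i)) ∎
    where open EquationalReasoning

filter-oneTo-↔ : {P : ℕ → Set a} (P? : Decidable P) → (∀ i → Irrelevant (P (suc i))) → ∀ n →
                 Fin (length (filter P? (oneTo n))) ↔ Σ ℕ (λ i → i < n × P (suc i))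
filter-oneTo-↔ P? P-irr n rewrite map-upTo suc n = filter-applyUpTo-↔ P? suc P-irr n

module _ {Q : ℕ × A → Set a} where

  Σ-curry-suc-↔ : (∀ {x} → ¬ Q (0 , x)) → Σ (ℕ × A) Q ↔ Σ ℕ (λ i → Σ A (λ x → Q (suc i , x)))
  Σ-curry-suc-↔ ¬Q₀ = mk↔ₛ′ to from (λ _ → refl) from∘to
    where
    to : Σ (ℕ × A) Q → Σ ℕ (λ i → Σ A (λ x → Q (suc i , x)))
    to ((zero , x) , q) = ⊥-elim (¬Q₀ q)
    to ((suc i , x) , q) = i , x , q
    from : Σ ℕ (λ i → Σ A (λ x → Q (suc i , x))) → Σ (ℕ × A) Q
    from (i , x , q) = (suc i , x) , q
    from∘to : ∀ y → from (to y) ≡ y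
    from∘to ((zero , x) , q) = ⊥-elim (¬Q₀ q)
    from∘to ((suc i , x) , q) = refl

s-even : ∀ u j a → s (u ℕ.* 2) (suc j) a ≡ (a ℤ.+ + (u ℕ.* j)) ℤ.* + suc j
s-even u zero a rewrite ℕ.*-zeroʳ u = trans (ℤ.+-identityˡ (a ℤ.+ + 0)) (sym (ℤ.*-identityʳ (a ℤ.+ + 0)))
s-even u (suc j) a = begin
    s (u ℕ.* 2) (suc j) a ℤ.+ (a ℤ.+ + (suc j ℕ.* (u ℕ.* 2)))
  ≡⟨ cong (ℤ._+ (a ℤ.+ + (suc j ℕ.* (u ℕ.* 2)))) (s-even u j a) ⟩
    (a ℤ.+ + (u ℕ.* j)) ℤ.* + suc j ℤ.+ (a ℤ.+ + (suc j ℕ.* (u ℕ.* 2)))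
  ≡⟨ cong₂ (λ x y → x ℤ.+ (a ℤ.+ y)) (cong₂ (λ x y → (a ℤ.+ x) ℤ.* y) (ℤ.pos-* u j) (ℤ.pos-+ 1 j)) cast ⟩
    (a ℤ.+ U ℤ.* J) ℤ.* (+ 1 ℤ.+ J) ℤ.+ (a ℤ.+ (+ 1 ℤ.+ J) ℤ.* (U ℤ.* + 2))
  ≡⟨ step a U J ⟩
    (a ℤ.+ U ℤ.* (+ 1 ℤ.+ J)) ℤ.* (+ 2 ℤ.+ J)
  ≡⟨ cong₂ (λ x y → (a ℤ.+ x) ℤ.* y) cast′ (ℤ.pos-+ 2 j) ⟨
    (a ℤ.+ + (u ℕ.* suc j)) ℤ.* + suc (suc j)
  ∎
  where
  open ≡-Reasoning
  U J : ℤ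
  U = + u
  J = + j
  cast : + (suc j ℕ.* (u ℕ.* 2)) ≡ (+ 1 ℤ.+ J) ℤ.* (U ℤ.* + 2)
  cast = trans (ℤ.pos-* (suc j) (u ℕ.* 2)) (cong₂ ℤ._*_ (ℤ.pos-+ 1 j) (ℤ.pos-* u 2))
  cast′ : + (u ℕ.* suc j) ≡ U ℤ.* (+ 1 ℤ.+ J)
  cast′ = trans (ℤ.pos-* u (suc j)) (cong (U ℤ.*_) (ℤ.pos-+ 1 j))
  step : ∀ a U J → (a ℤ.+ U ℤ.* J) ℤ.* (+ 1 ℤ.+ J) ℤ.+ (a ℤ.+ (+ 1 ℤ.+ J) ℤ.* (U ℤ.* + 2))
                 ≡ (a ℤ.+ U ℤ.* (+ 1 ℤ.+ J)) ℤ.* (+ 2 ℤ.+ J)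
  step = solve-∀

s-even-pos : ∀ u j a → s (u ℕ.* 2) (suc j) (+ a) ≡ + ((a ℕ.+ u ℕ.* j) ℕ.* suc j)
s-even-pos u j a = begin
  s (u ℕ.* 2) (suc j) (+ a)                  ≡⟨ s-even u j (+ a) ⟩
  (+ a ℤ.+ + (u ℕ.* j)) ℤ.* + suc j          ≡⟨ cong (ℤ._* + suc j) (ℤ.pos-+ a (u ℕ.* j)) ⟨
  + (a ℕ.+ u ℕ.* j) ℤ.* + suc j              ≡⟨ ℤ.pos-* (a ℕ.+ u ℕ.* j) (suc j) ⟨
  + ((a ℕ.+ u ℕ.* j) ℕ.* suc j)              ∎
  where open ≡-Reasoning

s-even-injective : ∀ u j {a b} → s (u ℕ.* 2) (suc j) a ≡ s (u ℕ.* 2) (suc j) b → a ≡ b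
s-even-injective u j {a} {b} e = +-cancelʳ (+ (u ℕ.* j)) a b
  (ℤ.*-cancelʳ-≡ _ _ (+ suc j) (trans (sym (s-even u j a)) (trans e (s-even u j b))))

s-even-∣ : ∀ u j {a n} → s (u ℕ.* 2) (suc j) a ≡ + n → suc j ∣ n
s-even-∣ u j {a} {n} e = divides ∣ c ∣ (begin
  n                    ≡⟨ cong ∣_∣ (trans (sym (s-even u j a)) e) ⟨
  ∣ c ℤ.* + suc j ∣    ≡⟨ ℤ.abs-* c (+ suc j) ⟩
  ∣ c ∣ ℕ.* suc j      ∎)
  where
  open ≡-Reasoning
  c = a ℤ.+ + (u ℕ.* j)

s-even-divisor : ∀ u j {q n} → n ≡ q ℕ.* suc j → s (u ℕ.* 2) (suc j) (+ q ℤ.- + (u ℕ.* j)) ≡ + n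
s-even-divisor u j {q} {n} n≡qk = begin
  s (u ℕ.* 2) (suc j) (+ q ℤ.- + (u ℕ.* j))
    ≡⟨ s-even u j _ ⟩
  (+ q ℤ.- + (u ℕ.* j) ℤ.+ + (u ℕ.* j)) ℤ.* + suc j
    ≡⟨ cong (ℤ._* + suc j) ([x-y]+y≡x (+ (u ℕ.* j)) (+ q)) ⟩
  + q ℤ.* + suc j
    ≡⟨ ℤ.pos-* q (suc j) ⟨
  + (q ℕ.* suc j)
    ≡⟨ cong +_ n≡qk ⟨
  + n ∎
  where open ≡-Reasoning

s-even-divisor-pos : ∀ u j {q n} → u ℕ.* j ≤ q → n ≡ q ℕ.* suc j →
                     s (u ℕ.* 2) (suc j) (+ (q ∸ u ℕ.* j)) ≡ + n
s-even-divisor-pos u j {q} {n} uj≤q n≡qk = begin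
  s (u ℕ.* 2) (suc j) (+ (q ∸ u ℕ.* j))     ≡⟨ s-even-pos u j (q ∸ u ℕ.* j) ⟩
  + ((q ∸ u ℕ.* j ℕ.+ u ℕ.* j) ℕ.* suc j)   ≡⟨ cong (λ x → + (x ℕ.* suc j)) (ℕ.m∸n+n≡m uj≤q) ⟩
  + (q ℕ.* suc j)                            ≡⟨ cong +_ n≡qk ⟨
  + n                                        ∎
  where open ≡-Reasoning

θ-divisor : ℕ → ℕ → ℕ → Set
θ-divisor t n k = k ∣ n × t ℕ.* (k ℕ.* (k ∸ 1)) < 2 ℕ.* n

below-θ⇔positive-start : ∀ u j {q n} → n ≡ q ℕ.* suc j →
                         (u ℕ.* 2 ℕ.* (suc j ℕ.* j) < 2 ℕ.* n) ⇔ (u ℕ.* j < q)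
below-θ⇔positive-start u j {q} refl = mk⇔
  (λ lt → ℕ.*-cancelʳ-< (suc j) _ _ (ℕ.*-cancelˡ-< 2 _ _ (subst (_< 2 ℕ.* (q ℕ.* suc j)) (regroup u j) lt)))
  (λ lt → subst (_< 2 ℕ.* (q ℕ.* suc j)) (sym (regroup u j)) (ℕ.*-monoʳ-< 2 (ℕ.*-monoˡ-< (suc j) lt)))
  where
  regroup : ∀ u j → u ℕ.* 2 ℕ.* (suc j ℕ.* j) ≡ 2 ℕ.* (u ℕ.* j ℕ.* suc j)
  regroup = ℕ.solve-∀

module _ (u : ℕ) {n : ℕ} .{{_ : NonZero n}} where

  divisors↔reps : Σ ℕ (λ j → j < n × suc j ∣ n) ↔ Σ (ℕ × ℤ) (Rep (u ℕ.* 2) n)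
  divisors↔reps = begin
    Σ ℕ (λ j → j < n × suc j ∣ n)
      ↔⟨ congˡ (λ {j} → ⇔⇒↔ (×-irrelevant ℕ.<-irrelevant ∣-irrelevant) (fibre-irrelevant j) (fibre⇔ j)) ⟩
    Σ ℕ (λ j → Σ ℤ (λ a → Rep (u ℕ.* 2) n (suc j , a)))
      ↔⟨ Σ-curry-suc-↔ (λ ()) ⟨
    Σ (ℕ × ℤ) (Rep (u ℕ.* 2) n) ∎
    where
    open EquationalReasoning
    fibre⇔ : ∀ j → (j < n × suc j ∣ n) ⇔ Σ ℤ (λ a → Rep (u ℕ.* 2) n (suc j , a))
    fibre⇔ j = mk⇔
      (λ { (_ , divides q n≡qk) → + q ℤ.- + (u ℕ.* j) , s≤s z≤n , s-even-divisor u j n≡qk })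
      (λ { (_ , _ , e) → ∣⇒≤ (s-even-∣ u j e) , s-even-∣ u j e })
    fibre-irrelevant : ∀ j → Irrelevant (Σ ℤ (λ a → Rep (u ℕ.* 2) n (suc j , a)))
    fibre-irrelevant j = Σ-irrelevant (λ (_ , e) (_ , e′) → s-even-injective u j (trans e (sym e′)))
                                      (×-irrelevant ℕ.≤-irrelevant ℤ-≡-irrelevant)

  θ-divisors↔positive-reps :
    Σ ℕ (λ j → j < n × θ-divisor (u ℕ.* 2) n (suc j)) ↔ Σ (ℕ × ℕ) (RepPos (u ℕ.* 2) n)
  θ-divisors↔positive-reps = begin
    Σ ℕ (λ j → j < n × θ-divisor (u ℕ.* 2) n (suc j))
      ↔⟨ congˡ (λ {j} → ⇔⇒↔ (×-irrelevant ℕ.<-irrelevant (×-irrelevant ∣-irrelevant ℕ.<-irrelevant))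
                            (fibre-irrelevant j) (fibre⇔ j)) ⟩
    Σ ℕ (λ j → Σ ℕ (λ a → RepPos (u ℕ.* 2) n (suc j , a)))
      ↔⟨ Σ-curry-suc-↔ (λ ()) ⟨
    Σ (ℕ × ℕ) (RepPos (u ℕ.* 2) n) ∎
    where
    open EquationalReasoning
    fibre⇔ : ∀ j → (j < n × θ-divisor (u ℕ.* 2) n (suc j)) ⇔ Σ ℕ (λ a → RepPos (u ℕ.* 2) n (suc j , a))
    fibre⇔ j = mk⇔ to from
      where
      to : j < n × θ-divisor (u ℕ.* 2) n (suc j) → Σ ℕ (λ a → RepPos (u ℕ.* 2) n (suc j , a))
      to (_ , divides q n≡qk , below-θ) =
        q ∸ u ℕ.* j , s≤s z≤n , ℕ.m<n⇒0<n∸m uj<q , s-even-divisor-pos u j (ℕ.<⇒≤ uj<q) n≡qk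
        where uj<q = Equivalence.to (below-θ⇔positive-start u j n≡qk) below-θ
      from : Σ ℕ (λ a → RepPos (u ℕ.* 2) n (suc j , a)) → j < n × θ-divisor (u ℕ.* 2) n (suc j)
      from (a , _ , 0<a , e) =
        ∣⇒≤ k∣n , k∣n , Equivalence.from (below-θ⇔positive-start u j n≡qk) (ℕ.m<n+m (u ℕ.* j) 0<a)
        where
        n≡qk = sym (ℤ.+-injective (trans (sym (s-even-pos u j a)) e))
        k∣n = divides (a ℕ.+ u ℕ.* j) n≡qk
    fibre-irrelevant : ∀ j → Irrelevant (Σ ℕ (λ a → RepPos (u ℕ.* 2) n (suc j , a)))
    fibre-irrelevant j =
      Σ-irrelevant (λ (_ , _ , e) (_ , _ , e′) → ℤ.+-injective (s-even-injective u j (trans e (sym e′))))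
                   (×-irrelevant ℕ.≤-irrelevant (×-irrelevant ℕ.≤-irrelevant ℤ-≡-irrelevant))

-- The argument also covers t = 0.
theorem3 : (t n : ℕ) → 1 ≤ t → 2 ∣ t → 1 ≤ n →
    HasCard (Rep t n) (d n) × HasCard (RepPos t n) (d-θ t n)
theorem3 .(u ℕ.* 2) n _ (divides u refl) 1≤n =
  ↔-trans (filter-oneTo-↔ (_∣? n) (λ _ → ∣-irrelevant) n) (divisors↔reps u) ,
  ↔-trans (filter-oneTo-↔ (λ k → (k ∣? n) ×-dec (u ℕ.* 2 ℕ.* (k ℕ.* (k ∸ 1)) ℕ.<? 2 ℕ.* n))
                          (λ _ → ×-irrelevant ∣-irrelevant ℕ.<-irrelevant) n)
          (θ-divisors↔positive-reps u)
  where instance _ = ℕ.>-nonZero 1≤n
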